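{- Let $G$ be a graph on $n$ vertices whose average degree is $D < n-1$. Then there exist two nonadjacent vertices $x,y\in V(G)$ such that $d(x)+d(y)\geq D$.
   Context: $d(v)$ denotes the degree of the vertex $v$ in $G$; the average degree is $D=\frac{2e(G)}{n}$. -}

module Defs where

open import Data.Nat using (ℕ; _+_)
open import Data.Fin using (Fin; _<_)
open import Data.Fin.Properties using (_<?_)
open import Data.List using (List; sum; map; length; filter)
open import Data.List.Base using (allFin; cartesianProduct)
open import Data.Product using (_×_; _,_; proj₁; proj₂)
open import Relation.Nullary using (¬_; Dec; yes; no)
open import Relation.Nullary.Decidable using (_×-dec_)
open import Relation.Binary.PropositionalEquality using (_≡_)

record Graph (n : ℕ) : Set₁ where
  field
    Adj     : Fin n → Fin n → Set
    adj?    : (x y : Fin n) → Dec (Adj x y)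
    sym     : ∀ {x y} → Adj x y → Adj y x
    irrefl  : ∀ x → ¬ Adj x x

open Graph public

degree : ∀ {n} (G : Graph n) → Fin n → ℕ
degree {n} G v = length (filter (adj? G v) (allFin n))

edgeCount : ∀ {n} (G : Graph n) → ℕ
edgeCount {n} G =
  length (filter (λ p → (proj₁ p <? proj₂ p) ×-dec adj? G (proj₁ p) (proj₂ p))
                 (cartesianProduct (allFin n) (allFin n)))

-- Take x of minimum degree δ. Since nδ ≤ 2e(G) < n(n-1), x has a non-neighbour
-- y ≠ x; choose one of maximum degree. Every vertex adjacent to x has degree at
-- most n-1, and every other vertex (x included) has degree at most d(y), so
-- 2e(G) = Σ d(z) ≤ δ(n-1) + n·d(y) ≤ n(d(x) + d(y)).
module Submission where

open import Defs hiding (sym)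
open import Data.Bool using (true; false; if_then_else_)
open import Data.Empty using (⊥-elim)
open import Data.Fin using (Fin; zero; suc; punchIn)
open import Data.Fin.Properties using (_<?_; _≟_; <-cmp; any?; punchInᵢ≢i)
open import Data.List using (List; _++_; map; tabulate; allFin; filter; length; cartesianProduct)
open import Data.List.Extrema.Nat using (argmin; argmax; f[argmin]≤f[xs]; f[xs]≤f[argmax]; argmax-all)
open import Data.List.Membership.Propositional.Properties using (∈-allFin; ∈-filter⁺)
open import Data.List.Properties using (length-++; filter-++; map-tabulate)
open import Data.List.Relation.Unary.All using (lookup)
open import Data.List.Relation.Unary.All.Properties using (all-filter)
open import Data.Nat using (ℕ; zero; suc; _+_; _*_; _∸_; _<_; _≤_; z≤n)
open import Data.Nat.Properties
  using (≤-refl; ≤-reflexive; ≤-trans; ≤-<-trans; <⇒≢; m≤m+n; n≤1+n; +-mono-≤; +-monoˡ-≤; *-monoʳ-≤;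
         *-cancelˡ-<; +-identityʳ; *-identityˡ; *-identityʳ; *-comm; *-distribˡ-+; +-*-semiring; module ≤-Reasoning)
open import Data.Product using (Σ; ∃; ∃-syntax; _×_; _,_; proj₁; proj₂)
open import Level using (Level)
open import Function using (_∘_; id)
open import Relation.Binary using (tri<; tri≈; tri>)
open import Relation.Binary.PropositionalEquality using (_≡_; _≢_; refl; sym; trans; cong; cong₂; module ≡-Reasoning)
open import Relation.Nullary using (¬_; Dec; yes; no; does)
open import Relation.Nullary.Decidable using (_×-dec_; ¬?; decidable-stable)
open import Relation.Unary using (Pred; Decidable)

open import Algebra.Properties.Semiring.Sum +-*-semiring
  using (sum-syntax; sum-cong-≗; sum-remove; ∑-distrib-+; ∑-comm; *-distribʳ-sum)

private
  variable
    a b p q : Level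
    A : Set a
    B : Set b
    P : Set p
    Q : Set q

𝟙 : Dec P → ℕ
𝟙 P? = if does P? then 1 else 0

𝟙≤1 : (P? : Dec P) → 𝟙 P? ≤ 1
𝟙≤1 (yes _) = ≤-refl
𝟙≤1 (no _)  = z≤n

𝟙-yes : P → (P? : Dec P) → 𝟙 P? ≡ 1
𝟙-yes p (yes _) = refl
𝟙-yes p (no ¬p) = ⊥-elim (¬p p)

𝟙-no : ¬ P → (P? : Dec P) → 𝟙 P? ≡ 0
𝟙-no ¬p (yes p) = ⊥-elim (¬p p)
𝟙-no ¬p (no _)  = refl

𝟙-⇔ : (P → Q) → (Q → P) → (P? : Dec P) (Q? : Dec Q) → 𝟙 P? ≡ 𝟙 Q?
𝟙-⇔ to from (yes p) Q? = sym (𝟙-yes (to p) Q?)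
𝟙-⇔ to from (no ¬p) Q? = sym (𝟙-no (¬p ∘ from) Q?)

𝟙-×-yes : P → (P? : Dec P) (Q? : Dec Q) → 𝟙 (P? ×-dec Q?) ≡ 𝟙 Q?
𝟙-×-yes p P? Q? = 𝟙-⇔ proj₂ (p ,_) (P? ×-dec Q?) Q?

𝟙-×-no : ¬ P → (P? : Dec P) (Q? : Dec Q) → 𝟙 (P? ×-dec Q?) ≡ 0
𝟙-×-no ¬p P? Q? = 𝟙-no (¬p ∘ proj₁) (P? ×-dec Q?)

∑-const : ∀ n c → ∑[ i < n ] c ≡ n * c
∑-const zero    c = refl
∑-const (suc n) c = cong (c +_) (∑-const n c)

∑-mono-≤ : ∀ {n} {f g : Fin n → ℕ} → (∀ i → f i ≤ g i) → ∑[ i < n ] f i ≤ ∑[ i < n ] g i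
∑-mono-≤ {zero}  f≤g = z≤n
∑-mono-≤ {suc n} f≤g = +-mono-≤ (f≤g zero) (∑-mono-≤ (f≤g ∘ suc))

count-tabulate : ∀ {n} {P : Pred A p} (P? : Decidable P) (f : Fin n → A) →
                 length (filter P? (tabulate f)) ≡ ∑[ i < n ] 𝟙 (P? (f i))
count-tabulate {n = zero}  P? f = refl
count-tabulate {n = suc n} P? f with does (P? (f zero))
... | true  = cong suc (count-tabulate P? (f ∘ suc))
... | false = count-tabulate P? (f ∘ suc)

count-cartesianProduct : ∀ {m n} {P : Pred (A × B) p} (P? : Decidable P) (f : Fin m → A) (g : Fin n → B) →
                         length (filter P? (cartesianProduct (tabulate f) (tabulate g)))
                           ≡ ∑[ i < m ] ∑[ j < n ] 𝟙 (P? (f i , g j))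
count-cartesianProduct {m = zero}  P? f g = refl
count-cartesianProduct {A = A} {B = B} {m = suc m} {n} P? f g = begin
  length (filter P? (row ++ rows))                 ≡⟨ cong length (filter-++ P? row rows) ⟩
  length (filter P? row ++ filter P? rows)         ≡⟨ length-++ (filter P? row) ⟩
  length (filter P? row) + length (filter P? rows) ≡⟨ cong₂ _+_ count-row (count-cartesianProduct P? (f ∘ suc) g) ⟩
  ∑[ j < n ] 𝟙 (P? (f zero , g j)) + ∑[ i < m ] ∑[ j < n ] 𝟙 (P? (f (suc i) , g j)) ∎
  where
  open ≡-Reasoning
  row rows : List (A × B)
  row  = map (f zero ,_) (tabulate g)
  rows = cartesianProduct (tabulate (f ∘ suc)) (tabulate g)
  count-row : length (filter P? row) ≡ ∑[ j < n ] 𝟙 (P? (f zero , g j))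
  count-row = trans (cong (length ∘ filter P?) (map-tabulate g (f zero ,_))) (count-tabulate P? ((f zero ,_) ∘ g))

∃-minimiser : ∀ {n} (f : Fin (suc n) → ℕ) → ∃[ x ] ∀ y → f x ≤ f y
∃-minimiser {n} f = argmin f zero (allFin (suc n)) , λ y →
  lookup (f[argmin]≤f[xs] {f = f} zero (allFin (suc n))) (∈-allFin y)

∃-maximiser-on : ∀ {n} {P : Pred (Fin n) p} → Decidable P → (f : Fin n → ℕ) →
                 ∃ P → ∃[ y ] P y × (∀ z → P z → f z ≤ f y)
∃-maximiser-on {n = n} P? f (y₀ , Py₀) = argmax f y₀ candidates , argmax-all f Py₀ (all-filter P? (allFin n)) ,
  λ z Pz → lookup (f[xs]≤f[argmax] {f = f} y₀ candidates) (∈-filter⁺ P? (∈-allFin z) Pz)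
  where
  candidates : List (Fin n)
  candidates = filter P? (allFin n)

module _ {n} (G : Graph n) where

  degree≡∑ : ∀ v → degree G v ≡ ∑[ y < n ] 𝟙 (adj? G v y)
  degree≡∑ v = count-tabulate (adj? G v) id

  edgeCount≡∑ : edgeCount G ≡ ∑[ x < n ] ∑[ y < n ] 𝟙 ((x <? y) ×-dec adj? G x y)
  edgeCount≡∑ = count-cartesianProduct (λ (x , y) → (x <? y) ×-dec adj? G x y) id id

  adj-split : ∀ x y → 𝟙 (adj? G x y) ≡ 𝟙 ((x <? y) ×-dec adj? G x y) + 𝟙 ((y <? x) ×-dec adj? G y x)
  adj-split x y with <-cmp x y
  ... | tri< x<y _ y≮x = sym (trans (cong₂ _+_ (𝟙-×-yes x<y (x <? y) (adj? G x y)) (𝟙-×-no y≮x (y <? x) (adj? G y x)))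
                                (+-identityʳ _))
  ... | tri> x≮y _ y<x = trans (𝟙-⇔ (Graph.sym G) (Graph.sym G) (adj? G x y) (adj? G y x))
                         (sym (cong₂ _+_ (𝟙-×-no x≮y (x <? y) (adj? G x y)) (𝟙-×-yes y<x (y <? x) (adj? G y x))))
  ... | tri≈ x≮x refl _ = trans (𝟙-no (irrefl G x) (adj? G x x))
                         (sym (cong₂ _+_ (𝟙-×-no x≮x (x <? x) (adj? G x x)) (𝟙-×-no x≮x (x <? x) (adj? G x x))))

  handshake : ∑[ v < n ] degree G v ≡ 2 * edgeCount G
  handshake = begin
    ∑[ v < n ] degree G v                                  ≡⟨ sum-cong-≗ (λ x → trans (degree≡∑ x) (sum-cong-≗ (adj-split x))) ⟩
    ∑[ x < n ] ∑[ y < n ] (E x y + E y x)                  ≡⟨ sum-cong-≗ (λ x → ∑-distrib-+ (E x) (λ y → E y x)) ⟩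
    ∑[ x < n ] (∑[ y < n ] E x y + ∑[ y < n ] E y x)       ≡⟨ ∑-distrib-+ (λ x → ∑[ y < n ] E x y) (λ x → ∑[ y < n ] E y x) ⟩
    e + ∑[ x < n ] ∑[ y < n ] E y x                        ≡⟨ cong (e +_) (∑-comm (λ x y → E y x)) ⟩
    e + e                                                  ≡⟨ cong₂ _+_ (sym edgeCount≡∑) (trans (sym edgeCount≡∑) (sym (+-identityʳ _))) ⟩
    2 * edgeCount G                                        ∎
    where
    open ≡-Reasoning
    E : Fin n → Fin n → ℕ
    E x y = 𝟙 ((x <? y) ×-dec adj? G x y)
    e : ℕ
    e = ∑[ x < n ] ∑[ y < n ] E x y

  n*δ≤2e : ∀ {x} → (∀ z → degree G x ≤ degree G z) → n * degree G x ≤ 2 * edgeCount G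
  n*δ≤2e {x} x-min = begin
    n * degree G x          ≡⟨ ∑-const n (degree G x) ⟨
    ∑[ z < n ] degree G x   ≤⟨ ∑-mono-≤ x-min ⟩
    ∑[ z < n ] degree G z   ≡⟨ handshake ⟩
    2 * edgeCount G         ∎
    where open ≤-Reasoning

module _ {m} (G : Graph (suc m)) where

  degree≡∑-punchIn : ∀ v → degree G v ≡ ∑[ j < m ] 𝟙 (adj? G v (punchIn v j))
  degree≡∑-punchIn v = begin
    degree G v                                               ≡⟨ degree≡∑ G v ⟩
    ∑[ y < suc m ] 𝟙 (adj? G v y)                            ≡⟨ sum-remove {i = v} (𝟙 ∘ adj? G v) ⟩
    𝟙 (adj? G v v) + ∑[ j < m ] 𝟙 (adj? G v (punchIn v j))  ≡⟨ cong (_+ ∑[ j < m ] 𝟙 (adj? G v (punchIn v j))) (𝟙-no (irrefl G v) (adj? G v v)) ⟩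
    ∑[ j < m ] 𝟙 (adj? G v (punchIn v j))                   ∎
    where open ≡-Reasoning

  degree≤m : ∀ v → degree G v ≤ m
  degree≤m v = begin
    degree G v                              ≡⟨ degree≡∑-punchIn v ⟩
    ∑[ j < m ] 𝟙 (adj? G v (punchIn v j))   ≤⟨ ∑-mono-≤ (λ j → 𝟙≤1 (adj? G v (punchIn v j))) ⟩
    ∑[ j < m ] 1                            ≡⟨ ∑-const m 1 ⟩
    m * 1                                   ≡⟨ *-identityʳ m ⟩
    m                                       ∎
    where open ≤-Reasoning

  non-neighbour : ∀ v → degree G v < m → ∃[ y ] v ≢ y × ¬ Adj G v y
  non-neighbour v δ<m with any? (λ j → ¬? (adj? G v (punchIn v j)))
  ... | yes (j , ¬v~j) = punchIn v j , punchInᵢ≢i v j ∘ sym , ¬v~j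
  ... | no none        = ⊥-elim (<⇒≢ δ<m degree≡m)
    where
    degree≡m : degree G v ≡ m
    degree≡m = begin
      degree G v                              ≡⟨ degree≡∑-punchIn v ⟩
      ∑[ j < m ] 𝟙 (adj? G v (punchIn v j))   ≡⟨ sum-cong-≗ (λ j → 𝟙-yes (decidable-stable (adj? G v (punchIn v j)) (none ∘ (j ,_))) (adj? G v (punchIn v j))) ⟩
      ∑[ j < m ] 1                            ≡⟨ ∑-const m 1 ⟩
      m * 1                                   ≡⟨ *-identityʳ m ⟩
      m                                       ∎
      where open ≡-Reasoning

  2e≤n*[dx+dy] : ∀ {x y} → degree G x ≤ degree G y → (∀ z → x ≢ z → ¬ Adj G x z → degree G z ≤ degree G y) →
                 2 * edgeCount G ≤ suc m * (degree G x + degree G y)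
  2e≤n*[dx+dy] {x} {y} dx≤dy dy-max = begin
    2 * edgeCount G                                  ≡⟨ handshake G ⟨
    ∑[ z < n ] d z                                   ≤⟨ ∑-mono-≤ d≤ ⟩
    ∑[ z < n ] (𝟙 (adj? G x z) * m + d y)            ≡⟨ ∑-distrib-+ (λ z → 𝟙 (adj? G x z) * m) (λ _ → d y) ⟩
    ∑[ z < n ] (𝟙 (adj? G x z) * m) + ∑[ z < n ] d y ≡⟨ cong₂ _+_ (sym (*-distribʳ-sum m (𝟙 ∘ adj? G x))) (∑-const n (d y)) ⟩
    ∑[ z < n ] 𝟙 (adj? G x z) * m + n * d y          ≡⟨ cong (λ k → k * m + n * d y) (degree≡∑ G x) ⟨
    d x * m + n * d y                                ≤⟨ +-monoˡ-≤ (n * d y) (*-monoʳ-≤ (d x) (n≤1+n m)) ⟩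
    d x * n + n * d y                                ≡⟨ cong (_+ n * d y) (*-comm (d x) n) ⟩
    n * d x + n * d y                                ≡⟨ *-distribˡ-+ n (d x) (d y) ⟨
    n * (d x + d y)                                  ∎
    where
    open ≤-Reasoning
    n : ℕ
    n = suc m
    d : Fin n → ℕ
    d = degree G
    d≤ : ∀ z → d z ≤ 𝟙 (adj? G x z) * m + d y
    d≤ z with adj? G x z | x ≟ z
    ... | yes _    | _        = ≤-trans (degree≤m z) (≤-trans (≤-reflexive (sym (*-identityˡ m))) (m≤m+n _ _))
    ... | no _     | yes refl = dx≤dy
    ... | no ¬x~z  | no x≢z   = dy-max z x≢z ¬x~z

lemma2p6 : (n : ℕ) (G : Graph n) →
    2 * edgeCount G < n * (n ∸ 1) →
    Σ (Fin n) (λ x → Σ (Fin n) (λ y →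
    ¬ (x ≡ y) × ¬ Adj G x y × 2 * edgeCount G ≤ n * (degree G x + degree G y)))
lemma2p6 zero    G ()
lemma2p6 (suc m) G 2e<n*m =
  let x , x-min = ∃-minimiser (degree G)
      δ<m       = *-cancelˡ-< (suc m) (degree G x) m (≤-<-trans (n*δ≤2e G x-min) 2e<n*m)
      y , (x≢y , ¬x~y) , y-max =
        ∃-maximiser-on (λ z → ¬? (x ≟ z) ×-dec ¬? (adj? G x z)) (degree G) (non-neighbour G x δ<m)
  in x , y , x≢y , ¬x~y , 2e≤n*[dx+dy] G (x-min y) (λ z x≢z ¬x~z → y-max z (x≢z , ¬x~z))
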